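{- Let $n\ge3$ be odd, let $L_n$ be the Laplacian of the path graph $P_n$, put $p^*:=\frac{n+1}{2}$, and for $j\in\{1,\dots,n\}$ let $\tilde L_n:=L_n+\epsilon e_je_j^T$. Let $a(s):=\det(sI-L_n)$. Then there is a polynomial $b_j(s)$, independent of $\epsilon$, of the form \[b_j(s)=-1+s\Big(\frac{(n-1)^2+2(n-1)}{4}+(j-p^*)^2\Big)+(\text{terms in } s^2 \text{ and higher}),\] such that $\det(sI-\tilde L_n)=a(s)+\epsilon\,b_j(s)$.
   Context: $e_j$ denotes the $j$-th column of $I_n$. The Laplacian of $P_n$ is the tridiagonal matrix with diagonal $(1,2,\dots,2,1)$ and sub/super-diagonal entries $-1$. -}

module Defs where

open import Data.Nat as ℕ using (ℕ; zero; suc; _<ᵇ_)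
open import Data.Integer using (ℤ; +_; -_; _+_; _-_; _*_)
open import Data.Fin using (Fin; toℕ; punchIn; _≟_)
import Data.Fin as Fin
open import Data.Bool using (Bool; true; false; if_then_else_; _∧_)
open import Data.List using (List; []; _∷_)
open import Relation.Nullary.Decidable using (⌊_⌋)

Mat : ℕ → Set
Mat n = Fin n → Fin n → ℤ

sumFin : ∀ n → (Fin n → ℤ) → ℤ
sumFin zero    f = + 0
sumFin (suc n) f = f Fin.zero + sumFin n (λ i → f (Fin.suc i))

sign : ℕ → ℤ
sign zero          = + 1
sign (suc zero)    = - (+ 1)
sign (suc (suc k)) = sign k

det : ∀ n → Mat n → ℤ
det zero    M = + 1
det (suc n) M =
  sumFin (suc n) (λ k → sign (toℕ k) * M Fin.zero k
                         * det n (λ i j → M (Fin.suc i) (punchIn k j)))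

δ : ∀ {n} → Fin n → Fin n → ℤ
δ i j = if ⌊ i ≟ j ⌋ then + 1 else + 0

pathAdj : ∀ {n} → Fin n → Fin n → Bool
pathAdj i j = ⌊ suc (toℕ i) ℕ.≟ toℕ j ⌋ Data.Bool.∨ ⌊ suc (toℕ j) ℕ.≟ toℕ i ⌋
  where import Data.Bool

pathDeg : ∀ n → Fin n → ℤ
pathDeg n i = sumFin n (λ j → if pathAdj i j then + 1 else + 0)

pathLap : ∀ n → Mat n
pathLap n i j = if ⌊ i ≟ j ⌋ then pathDeg n i
                else (if pathAdj i j then - (+ 1) else + 0)

perturbedLap : ∀ n → Fin n → ℤ → Mat n
perturbedLap n j ε a b = pathLap n a b + ε * (δ a j * δ b j)

charMat : ∀ n → ℤ → Mat n → Mat n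
charMat n s M i j = s * δ i j - M i j

-- Polynomials as coefficient lists (constant term first), evaluated by Horner.
eval : List ℤ → ℤ → ℤ
eval []       s = + 0
eval (c ∷ cs) s = c + s * eval cs s

module Submission where

-- sI − L̃ₙ is tridiagonal with unit off-diagonal entries, so its determinant is the continuant of
-- its diagonal. A continuant is affine in each diagonal entry: lowering the entry at 0-based
-- position i = j − 1 by ε lowers the continuant by ε times the continuants of the i entries before
-- and the r = n − 1 − i entries after it. Those are the characteristic polynomials E_i, E_r of
-- paths grounded at an end vertex, and E_m(s) = (−1)^m − (−1)^m (m(m+1)/2) s + O(s²). Hence
-- b_j = −E_i E_r; since i + r = n − 1 is even, its constant term is −1 and its linear coefficient
-- is i(i+1)/2 + r(r+1)/2, which is ((n−1)² + 2(n−1))/4 + (j − p*)² by completing the square.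

open import Defs
open import Data.Nat using (ℕ; zero; suc; _≤_; _<_; _∸_; _^_; _/_; _%_; _<ᵇ_; _≡ᵇ_; z≤n; s≤s)
import Data.Nat as ℕ
import Data.Nat.Properties as ℕₚ
open import Data.Nat.DivMod using (m≡m%n+[m/n]*n; m*n/n≡m)
import Data.Nat.Tactic.RingSolver as ℕSolver
open import Data.Integer using (ℤ; +_; -_; _+_; _-_; _*_)
import Data.Integer as ℤ
open import Data.Integer.Properties
  using (*-identityˡ; *-identityʳ; *-zeroʳ; +-identityˡ; +-identityʳ; -1*i≡-i; *-cancelʳ-≡; pos-+; pos-*)
open import Data.Integer.Tactic.RingSolver using (solve-∀)
open import Data.Fin using (Fin; toℕ; punchIn; _≟_)
import Data.Fin as Fin
open import Data.Fin.Properties using (toℕ-injective; toℕ<n)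
open import Data.Bool using (Bool; true; false; if_then_else_; _∨_)
open import Data.Bool.Properties using (T-≡)
open import Data.List using (List; []; _∷_; map)
open import Data.Product using (∃; _,_)
open import Data.Empty using (⊥-elim)
open import Function using (_∘_; Equivalence)
open import Relation.Nullary.Decidable using (yes; no; isYes≗does; dec-true; dec-false)
open import Relation.Binary.PropositionalEquality
  using (_≡_; _≢_; refl; sym; trans; cong; cong₂; subst; subst₂; module ≡-Reasoning)

open ≡-Reasoning

sumFin-cong : ∀ n {f g : Fin n → ℤ} → (∀ k → f k ≡ g k) → sumFin n f ≡ sumFin n g
sumFin-cong zero    f≗g = refl
sumFin-cong (suc n) f≗g = cong₂ _+_ (f≗g Fin.zero) (sumFin-cong n (f≗g ∘ Fin.suc))

sumFin-zero : ∀ n {f : Fin n → ℤ} → (∀ k → f k ≡ + 0) → sumFin n f ≡ + 0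
sumFin-zero zero    f≗0 = refl
sumFin-zero (suc n) f≗0 = cong₂ _+_ (f≗0 Fin.zero) (sumFin-zero n (f≗0 ∘ Fin.suc))

det-cong : ∀ n {M N : Mat n} → (∀ i j → M i j ≡ N i j) → det n M ≡ det n N
det-cong zero    M≗N = refl
det-cong (suc n) M≗N = sumFin-cong (suc n) λ k →
  cong₂ (λ x y → sign (toℕ k) * x * y) (M≗N Fin.zero k)
        (det-cong n (λ i j → M≗N (Fin.suc i) (punchIn k j)))

det-firstColumn : ∀ m (M : Mat (suc m)) → (∀ i → M (Fin.suc i) Fin.zero ≡ + 0) →
  det (suc m) M ≡ M Fin.zero Fin.zero * det m (λ i j → M (Fin.suc i) (Fin.suc j))
det-firstColumn zero    M _   = expand (M Fin.zero Fin.zero)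
  where
  expand : ∀ x → + 1 * x * + 1 + + 0 ≡ x * + 1
  expand = solve-∀
det-firstColumn (suc m) M col =
  trans (cong₂ _+_ (cong (_* D) (*-identityˡ (M Fin.zero Fin.zero))) (sumFin-zero (suc m) minor-vanishes))
        (+-identityʳ (M Fin.zero Fin.zero * D))
  where
  D = det (suc m) (λ i j → M (Fin.suc i) (Fin.suc j))
  minor-vanishes : ∀ k → sign (toℕ (Fin.suc k)) * M Fin.zero (Fin.suc k)
                           * det (suc m) (λ i j → M (Fin.suc i) (punchIn (Fin.suc k) j)) ≡ + 0
  minor-vanishes k =
    trans (cong (c *_) (trans (det-firstColumn m N (col ∘ Fin.suc)) (cong (_* D′) (col Fin.zero))))
          (*-zeroʳ c)
    where
    c = sign (toℕ (Fin.suc k)) * M Fin.zero (Fin.suc k)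
    N : Mat (suc m)
    N i j = M (Fin.suc i) (punchIn (Fin.suc k) j)
    D′ = det m (λ i j → N (Fin.suc i) (Fin.suc j))

det-tridiagonalStep : ∀ m (M : Mat (suc (suc m))) →
  (∀ k → M Fin.zero (Fin.suc (Fin.suc k)) ≡ + 0) → (∀ i → M (Fin.suc (Fin.suc i)) Fin.zero ≡ + 0) →
  det (suc (suc m)) M
    ≡ M Fin.zero Fin.zero * det (suc m) (λ i j → M (Fin.suc i) (Fin.suc j))
      - M Fin.zero (Fin.suc Fin.zero) * M (Fin.suc Fin.zero) Fin.zero
        * det m (λ i j → M (Fin.suc (Fin.suc i)) (Fin.suc (Fin.suc j)))
det-tridiagonalStep m M row col =
  trans (cong₂ (λ x y → + 1 * M₀₀ * D₁ + (- (+ 1) * M₀₁ * x + y))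
               (det-firstColumn m (λ i j → M (Fin.suc i) (punchIn (Fin.suc Fin.zero) j)) col)
               (sumFin-zero m entry-vanishes))
        (expand M₀₀ M₀₁ M₁₀ D₁ D₂)
  where
  M₀₀ = M Fin.zero Fin.zero
  M₀₁ = M Fin.zero (Fin.suc Fin.zero)
  M₁₀ = M (Fin.suc Fin.zero) Fin.zero
  D₁ = det (suc m) (λ i j → M (Fin.suc i) (Fin.suc j))
  D₂ = det m (λ i j → M (Fin.suc (Fin.suc i)) (Fin.suc (Fin.suc j)))
  expand : ∀ a b c x y → + 1 * a * x + (- (+ 1) * b * (c * y) + + 0) ≡ a * x - b * c * y
  expand = solve-∀
  entry-vanishes : ∀ k → sign (toℕ (Fin.suc (Fin.suc k))) * M Fin.zero (Fin.suc (Fin.suc k))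
                           * det (suc m) (λ i j → M (Fin.suc i) (punchIn (Fin.suc (Fin.suc k)) j)) ≡ + 0
  entry-vanishes k =
    trans (cong (λ x → sign (toℕ k) * x * minor) (row k)) (cong (_* minor) (*-zeroʳ (sign (toℕ k))))
    where minor = det (suc m) (λ i j → M (Fin.suc i) (punchIn (Fin.suc (Fin.suc k)) j))

continuant : ℕ → (ℕ → ℤ) → ℤ
continuant zero          d = + 1
continuant (suc zero)    d = d 0
continuant (suc (suc m)) d = d 0 * continuant (suc m) (d ∘ suc) - continuant m (d ∘ suc ∘ suc)

continuant-cong : ∀ m {d d′ : ℕ → ℤ} → (∀ i → d i ≡ d′ i) → continuant m d ≡ continuant m d′
continuant-cong zero          d≗d′ = refl
continuant-cong (suc zero)    d≗d′ = d≗d′ 0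
continuant-cong (suc (suc m)) d≗d′ =
  cong₂ _-_ (cong₂ _*_ (d≗d′ 0) (continuant-cong (suc m) (d≗d′ ∘ suc)))
            (continuant-cong m (d≗d′ ∘ suc ∘ suc))

continuant-snoc : ∀ m d → continuant (suc (suc m)) d ≡ d (suc m) * continuant (suc m) d - continuant m d
continuant-snoc zero          d = swap (d 0) (d 1)
  where
  swap : ∀ a b → a * b - + 1 ≡ b * a - + 1
  swap = solve-∀
continuant-snoc (suc zero)    d = rotate (d 0) (d 1) (d 2)
  where
  rotate : ∀ a b c → a * (b * c - + 1) - c ≡ c * (a * b - + 1) - a
  rotate = solve-∀
continuant-snoc (suc (suc m)) d =
  trans (cong₂ (λ x y → d 0 * x - y) (continuant-snoc (suc m) (d ∘ suc)) (continuant-snoc m (d ∘ suc ∘ suc)))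
        (regroup (d 0) (d (3 ℕ.+ m)) (continuant (suc (suc m)) (d ∘ suc)) (continuant (suc m) (d ∘ suc))
                 (continuant (suc m) (d ∘ suc ∘ suc)) (continuant m (d ∘ suc ∘ suc)))
  where
  regroup : ∀ a x p q r u → a * (x * p - q) - (x * r - u) ≡ x * (a * p - r) - (a * q - u)
  regroup = solve-∀

update : (ℕ → ℤ) → ℕ → ℤ → ℕ → ℤ
update d j e i = if i ≡ᵇ j then d i + e else d i

continuant-update : ∀ j r d e →
  continuant (j ℕ.+ suc r) (update d j e)
    ≡ continuant (j ℕ.+ suc r) d + e * continuant j d * continuant r (λ i → d (suc (j ℕ.+ i)))
continuant-update zero zero d e = cong (λ x → d 0 + x) (sym (trans (*-identityʳ (e * + 1)) (*-identityʳ e)))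
continuant-update zero (suc r) d e =
  distrib (d 0) e (continuant (suc r) (d ∘ suc)) (continuant r (d ∘ suc ∘ suc))
  where
  distrib : ∀ a e p q → (a + e) * p - q ≡ a * p - q + e * + 1 * p
  distrib = solve-∀
continuant-update (suc zero) r d e =
  trans (cong (λ x → d 0 * x - continuant r (d ∘ suc ∘ suc)) (continuant-update zero r (d ∘ suc) e))
        (distrib (d 0) (continuant (suc r) (d ∘ suc)) (continuant r (d ∘ suc ∘ suc)) e)
  where
  distrib : ∀ a p q e → a * (p + e * + 1 * q) - q ≡ a * p - q + e * a * q
  distrib = solve-∀
continuant-update (suc (suc j)) r d e =
  trans (cong₂ (λ x y → d 0 * x - y) (continuant-update (suc j) r (d ∘ suc) e)
                                     (continuant-update j r (d ∘ suc ∘ suc) e))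
        (distrib (d 0) (continuant (suc j ℕ.+ suc r) (d ∘ suc)) (continuant (j ℕ.+ suc r) (d ∘ suc ∘ suc))
                 (continuant (suc j) (d ∘ suc)) (continuant j (d ∘ suc ∘ suc))
                 (continuant r (λ i → d (3 ℕ.+ (j ℕ.+ i)))) e)
  where
  distrib : ∀ a p q x y z e → a * (p + e * x * z) - (q + e * y * z) ≡ a * p - q + e * (a * x - y) * z
  distrib = solve-∀

-- does (x ℕₚ.≟ y) computes to x ≡ᵇ y, so _≡ᵇ_ inherits the facts about _≟_.
≡ᵇ-refl : ∀ x → (x ≡ᵇ x) ≡ true
≡ᵇ-refl x = dec-true (x ℕₚ.≟ x) refl

≢⇒≡ᵇ-false : ∀ {x y} → x ≢ y → (x ≡ᵇ y) ≡ false
≢⇒≡ᵇ-false {x} {y} = dec-false (x ℕₚ.≟ y)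

adjacent : ℕ → ℕ → Bool
adjacent x y = (suc x ≡ᵇ y) ∨ (suc y ≡ᵇ x)

𝟙 : Bool → ℤ
𝟙 b = if b then + 1 else + 0

-- Entries are decided on toℕ with _≡ᵇ_ (rather than Fin's _≟_) so that deleting the first row
-- and column of a tridiagonal matrix gives a tridiagonal matrix definitionally.
tridiagonal : ∀ m → (ℕ → ℤ) → Mat m
tridiagonal m d a b = if toℕ a ≡ᵇ toℕ b then d (toℕ a) else 𝟙 (adjacent (toℕ a) (toℕ b))

det-tridiagonal : ∀ m d → det m (tridiagonal m d) ≡ continuant m d
det-tridiagonal zero          d = refl
det-tridiagonal (suc zero)    d = expand (d 0)
  where
  expand : ∀ x → + 1 * x * + 1 + + 0 ≡ x
  expand = solve-∀
det-tridiagonal (suc (suc m)) d =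
  trans (det-tridiagonalStep m (tridiagonal (suc (suc m)) d) (λ _ → refl) (λ _ → refl))
        (cong₂ (λ x y → d 0 * x - y) (det-tridiagonal (suc m) (d ∘ suc))
               (trans (*-identityˡ _) (det-tridiagonal m (d ∘ suc ∘ suc))))

+-*-zeroʳ : ∀ x e → x + e * + 0 ≡ x
+-*-zeroʳ = solve-∀

tridiagonal-update : ∀ n d e (j a b : Fin n) →
  tridiagonal n d a b + e * (δ a j * δ b j) ≡ tridiagonal n (update d (toℕ j) e) a b
tridiagonal-update n d e j a b with a ≟ b
... | no a≢b rewrite ≢⇒≡ᵇ-false (a≢b ∘ toℕ-injective) with a ≟ j | b ≟ j
...   | yes refl | yes refl = ⊥-elim (a≢b refl)
...   | yes refl | no _     = +-*-zeroʳ (𝟙 (adjacent (toℕ a) (toℕ b))) e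
...   | no _     | _        = +-*-zeroʳ (𝟙 (adjacent (toℕ a) (toℕ b))) e
tridiagonal-update n d e j a b | yes refl rewrite ≡ᵇ-refl (toℕ a) with a ≟ j
... | yes refl rewrite ≡ᵇ-refl (toℕ a) = cong (λ t → d (toℕ a) + t) (*-identityʳ e)
... | no a≢j rewrite ≢⇒≡ᵇ-false (a≢j ∘ toℕ-injective) = +-*-zeroʳ (d (toℕ a)) e

pathDegree : ℕ → ℕ → ℤ
pathDegree n x = 𝟙 (suc x <ᵇ n) + 𝟙 (0 <ᵇ x)

pathDiagonal : ℕ → ℤ → ℕ → ℤ
pathDiagonal n s x = s - pathDegree n x

pathAdj≡adjacent : ∀ {n} (a b : Fin n) → pathAdj a b ≡ adjacent (toℕ a) (toℕ b)
pathAdj≡adjacent a b = cong₂ _∨_ (isYes≗does (suc (toℕ a) ℕₚ.≟ toℕ b)) (isYes≗does (suc (toℕ b) ℕₚ.≟ toℕ a))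

sumFin-adjacent : ∀ n x → x < n → sumFin n (λ k → 𝟙 (adjacent x (toℕ k))) ≡ pathDegree n x
sumFin-adjacent (suc n) zero    _         = trans (+-identityˡ _) (rightNeighbour n)
  where
  rightNeighbour : ∀ n → sumFin n (λ k → 𝟙 ((0 ≡ᵇ toℕ k) ∨ false)) ≡ pathDegree (suc n) 0
  rightNeighbour zero    = refl
  rightNeighbour (suc n) = cong (λ t → + 1 + t) (sumFin-zero n (λ _ → refl))
sumFin-adjacent (suc n) (suc x) (s≤s x<n) =
  trans (cong (λ t → 𝟙 (0 ≡ᵇ x) + t) (sumFin-adjacent n x x<n)) (leftNeighbour x)
  where
  leftNeighbour : ∀ x → 𝟙 (0 ≡ᵇ x) + pathDegree n x ≡ pathDegree (suc n) (suc x)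
  leftNeighbour zero    = swap (𝟙 (1 <ᵇ n))
    where
    swap : ∀ a → + 1 + (a + + 0) ≡ a + + 1
    swap = solve-∀
  leftNeighbour (suc x) = +-identityˡ _

pathDeg≡pathDegree : ∀ n (a : Fin n) → pathDeg n a ≡ pathDegree n (toℕ a)
pathDeg≡pathDegree n a =
  trans (sumFin-cong n (λ k → cong 𝟙 (pathAdj≡adjacent a k))) (sumFin-adjacent n (toℕ a) (toℕ<n a))

charMat-pathLap : ∀ n s (a b : Fin n) →
  charMat n s (pathLap n) a b ≡ tridiagonal n (pathDiagonal n s) a b
charMat-pathLap n s a b with a ≟ b
... | yes refl rewrite ≡ᵇ-refl (toℕ a) | pathDeg≡pathDegree n a =
  cong (_- pathDegree n (toℕ a)) (*-identityʳ s)
... | no a≢b rewrite ≢⇒≡ᵇ-false (a≢b ∘ toℕ-injective) | pathAdj≡adjacent a b | *-zeroʳ s =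
  offDiagonal (adjacent (toℕ a) (toℕ b))
  where
  offDiagonal : ∀ A → + 0 - (if A then - (+ 1) else + 0) ≡ 𝟙 A
  offDiagonal true  = refl
  offDiagonal false = refl

charMat-perturbedLap : ∀ n s ε (j a b : Fin n) →
  charMat n s (perturbedLap n j ε) a b ≡ tridiagonal n (update (pathDiagonal n s) (toℕ j) (- ε)) a b
charMat-perturbedLap n s ε j a b = begin
  s * δ a b - (pathLap n a b + ε * (δ a j * δ b j))
    ≡⟨ separate s (δ a b) (pathLap n a b) ε (δ a j * δ b j) ⟩
  charMat n s (pathLap n) a b + - ε * (δ a j * δ b j)
    ≡⟨ cong (λ x → x + - ε * (δ a j * δ b j)) (charMat-pathLap n s a b) ⟩
  tridiagonal n (pathDiagonal n s) a b + - ε * (δ a j * δ b j)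
    ≡⟨ tridiagonal-update n (pathDiagonal n s) (- ε) j a b ⟩
  tridiagonal n (update (pathDiagonal n s) (toℕ j) (- ε)) a b ∎
  where
  separate : ∀ s x p ε y → s * x - (p + ε * y) ≡ s * x - p + - ε * y
  separate = solve-∀

det-charMat-pathLap : ∀ n s → det n (charMat n s (pathLap n)) ≡ continuant n (pathDiagonal n s)
det-charMat-pathLap n s = trans (det-cong n (charMat-pathLap n s)) (det-tridiagonal n (pathDiagonal n s))

det-charMat-perturbedLap : ∀ n s ε (j : Fin n) →
  det n (charMat n s (perturbedLap n j ε)) ≡ continuant n (update (pathDiagonal n s) (toℕ j) (- ε))
det-charMat-perturbedLap n s ε j =
  trans (det-cong n (charMat-perturbedLap n s ε j)) (det-tridiagonal n (update (pathDiagonal n s) (toℕ j) (- ε)))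

-- det (sI − L) for L the Laplacian of P_(m+1) with an end vertex deleted: the tridiagonal
-- matrix with diagonal (1, 2, …, 2) and off-diagonal −1.
groundedCharPoly : ℕ → ℤ → ℤ
groundedCharPoly zero          s = + 1
groundedCharPoly (suc zero)    s = s - + 1
groundedCharPoly (suc (suc m)) s = (s - + 2) * groundedCharPoly (suc m) s - groundedCharPoly m s

<⇒<ᵇ-true : ∀ {m n} → m < n → (m <ᵇ n) ≡ true
<⇒<ᵇ-true m<n = Equivalence.to T-≡ (ℕₚ.<⇒<ᵇ m<n)

continuant-pathDiagonal-prefix : ∀ {n} m s → m < n → continuant m (pathDiagonal n s) ≡ groundedCharPoly m s
continuant-pathDiagonal-prefix zero s _ = refl
continuant-pathDiagonal-prefix {n} (suc zero) s 1<n rewrite <⇒<ᵇ-true 1<n = refl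
continuant-pathDiagonal-prefix {n} (suc (suc m)) s m+2<n =
  trans (continuant-snoc m (pathDiagonal n s))
        (cong₂ _-_ (cong₂ _*_ interior (continuant-pathDiagonal-prefix (suc m) s m+1<n))
                   (continuant-pathDiagonal-prefix m s (ℕₚ.<⇒≤ m+1<n)))
  where
  m+1<n = ℕₚ.<⇒≤ m+2<n
  interior : pathDiagonal n s (suc m) ≡ s - + 2
  interior rewrite <⇒<ᵇ-true m+2<n = refl

pathDiagonal-suffix : ∀ j n s x → pathDiagonal (j ℕ.+ n) s (suc (j ℕ.+ x)) ≡ pathDiagonal n s (suc x)
pathDiagonal-suffix zero    n s x = refl
pathDiagonal-suffix (suc j) n s x = pathDiagonal-suffix j n s x

continuant-pathDiagonal-suffix : ∀ m s → continuant m (λ i → pathDiagonal (suc m) s (suc i)) ≡ groundedCharPoly m s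
continuant-pathDiagonal-suffix zero          s = refl
continuant-pathDiagonal-suffix (suc zero)    s = refl
continuant-pathDiagonal-suffix (suc (suc m)) s =
  cong₂ (λ x y → (s - + 2) * x - y) (continuant-pathDiagonal-suffix (suc m) s) (continuant-pathDiagonal-suffix m s)

continuant-pathDiagonal-update : ∀ j r s e →
  continuant (j ℕ.+ suc r) (update (pathDiagonal (j ℕ.+ suc r) s) j e)
    ≡ continuant (j ℕ.+ suc r) (pathDiagonal (j ℕ.+ suc r) s) + e * groundedCharPoly j s * groundedCharPoly r s
continuant-pathDiagonal-update j r s e =
  trans (continuant-update j r (pathDiagonal (j ℕ.+ suc r) s) e)
        (cong₂ (λ x y → continuant (j ℕ.+ suc r) (pathDiagonal (j ℕ.+ suc r) s) + e * x * y)
               (continuant-pathDiagonal-prefix j s (ℕₚ.m<m+n j (s≤s z≤n)))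
               (trans (continuant-cong r (pathDiagonal-suffix j (suc r) s))
                      (continuant-pathDiagonal-suffix r s)))

infixl 6 _+ₚ_
infixl 7 _*ₚ_

_+ₚ_ : List ℤ → List ℤ → List ℤ
[]      +ₚ q       = q
(a ∷ p) +ₚ []      = a ∷ p
(a ∷ p) +ₚ (b ∷ q) = a + b ∷ p +ₚ q

_*ₚ_ : List ℤ → List ℤ → List ℤ
[]      *ₚ q = []
(a ∷ p) *ₚ q = map (a *_) q +ₚ (+ 0 ∷ p *ₚ q)

eval-+ₚ : ∀ p q s → eval (p +ₚ q) s ≡ eval p s + eval q s
eval-+ₚ []      q       s = sym (+-identityˡ (eval q s))
eval-+ₚ (a ∷ p) []      s = sym (+-identityʳ (a + s * eval p s))
eval-+ₚ (a ∷ p) (b ∷ q) s =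
  trans (cong (λ x → a + b + s * x) (eval-+ₚ p q s)) (interchange a b s (eval p s) (eval q s))
  where
  interchange : ∀ a b s x y → a + b + s * (x + y) ≡ a + s * x + (b + s * y)
  interchange = solve-∀

eval-scale : ∀ a p s → eval (map (a *_) p) s ≡ a * eval p s
eval-scale a []      s = sym (*-zeroʳ a)
eval-scale a (b ∷ p) s = trans (cong (λ x → a * b + s * x) (eval-scale a p s)) (factor a b s (eval p s))
  where
  factor : ∀ a b s x → a * b + s * (a * x) ≡ a * (b + s * x)
  factor = solve-∀

eval-*ₚ : ∀ p q s → eval (p *ₚ q) s ≡ eval p s * eval q s
eval-*ₚ []      q s = refl
eval-*ₚ (a ∷ p) q s =
  trans (eval-+ₚ (map (a *_) q) (+ 0 ∷ p *ₚ q) s)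
        (trans (cong₂ (λ x y → x + (+ 0 + s * y)) (eval-scale a q s) (eval-*ₚ p q s))
               (factor a s (eval p s) (eval q s)))
  where
  factor : ∀ a s x y → a * y + (+ 0 + s * (x * y)) ≡ (a + s * x) * y
  factor = solve-∀

record HasLowCoeffs (f : ℤ → ℤ) (c₀ c₁ : ℤ) : Set where
  constructor _,_
  field
    rest      : List ℤ
    expansion : ∀ s → f s ≡ eval (c₀ ∷ c₁ ∷ rest) s

HasLowCoeffs-affine : ∀ c → HasLowCoeffs (λ s → s + c) c (+ 1)
HasLowCoeffs-affine c = [] , λ s → affine s c
  where
  affine : ∀ s c → s + c ≡ c + s * (+ 1 + s * + 0)
  affine = solve-∀

HasLowCoeffs-neg : ∀ {f a₀ a₁} → HasLowCoeffs f a₀ a₁ → HasLowCoeffs (λ s → - f s) (- a₀) (- a₁)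
HasLowCoeffs-neg {f} {a₀} {a₁} (p , f≡) = map (- + 1 *_) p , λ s →
  trans (cong -_ (f≡ s)) (trans (negate a₀ a₁ s (eval p s)) (cong (λ x → - a₀ + s * (- a₁ + s * x)) (sym (eval-scale (- + 1) p s))))
  where
  negate : ∀ a₀ a₁ s x → - (a₀ + s * (a₁ + s * x)) ≡ - a₀ + s * (- a₁ + s * (- + 1 * x))
  negate = solve-∀

HasLowCoeffs-+ : ∀ {f g a₀ a₁ b₀ b₁} → HasLowCoeffs f a₀ a₁ → HasLowCoeffs g b₀ b₁ →
  HasLowCoeffs (λ s → f s + g s) (a₀ + b₀) (a₁ + b₁)
HasLowCoeffs-+ {a₀ = a₀} {a₁} {b₀} {b₁} (p , f≡) (q , g≡) = p +ₚ q , λ s →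
  trans (cong₂ _+_ (f≡ s) (g≡ s))
        (trans (collect a₀ a₁ b₀ b₁ s (eval p s) (eval q s))
               (cong (λ x → a₀ + b₀ + s * (a₁ + b₁ + s * x)) (sym (eval-+ₚ p q s))))
  where
  collect : ∀ a₀ a₁ b₀ b₁ s x y →
    a₀ + s * (a₁ + s * x) + (b₀ + s * (b₁ + s * y)) ≡ a₀ + b₀ + s * (a₁ + b₁ + s * (x + y))
  collect = solve-∀

HasLowCoeffs-* : ∀ {f g a₀ a₁ b₀ b₁} → HasLowCoeffs f a₀ a₁ → HasLowCoeffs g b₀ b₁ →
  HasLowCoeffs (λ s → f s * g s) (a₀ * b₀) (a₀ * b₁ + a₁ * b₀)
HasLowCoeffs-* {a₀ = a₀} {a₁} {b₀} {b₁} (p , f≡) (q , g≡) = rest , λ s →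
  trans (cong₂ _*_ (f≡ s) (g≡ s))
        (trans (collect a₀ a₁ b₀ b₁ s (eval p s) (eval q s))
               (cong (λ x → a₀ * b₀ + s * (a₀ * b₁ + a₁ * b₀ + s * x)) (sym (eval-rest s))))
  where
  head = a₁ * b₁ ∷ + 0 ∷ p *ₚ q
  f₁ = a₀ ∷ a₁ ∷ []
  g₁ = b₀ ∷ b₁ ∷ []
  rest = head +ₚ (f₁ *ₚ q +ₚ g₁ *ₚ p)
  eval-rest : ∀ s → eval rest s
    ≡ a₁ * b₁ + s * (+ 0 + s * (eval p s * eval q s))
      + ((a₀ + s * (a₁ + s * + 0)) * eval q s + (b₀ + s * (b₁ + s * + 0)) * eval p s)
  eval-rest s =
    trans (eval-+ₚ head (f₁ *ₚ q +ₚ g₁ *ₚ p) s)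
          (cong₂ _+_ (cong (λ x → a₁ * b₁ + s * (+ 0 + s * x)) (eval-*ₚ p q s))
                     (trans (eval-+ₚ (f₁ *ₚ q) (g₁ *ₚ p) s)
                            (cong₂ _+_ (eval-*ₚ f₁ q s) (eval-*ₚ g₁ p s))))
  collect : ∀ a₀ a₁ b₀ b₁ s x y →
    (a₀ + s * (a₁ + s * x)) * (b₀ + s * (b₁ + s * y))
      ≡ a₀ * b₀ + s * (a₀ * b₁ + a₁ * b₀ + s * (a₁ * b₁ + s * (+ 0 + s * (x * y))
          + ((a₀ + s * (a₁ + s * + 0)) * y + (b₀ + s * (b₁ + s * + 0)) * x)))
  collect = solve-∀

triangle : ℕ → ℤ
triangle zero    = + 0
triangle (suc m) = triangle m + + suc m

sign-suc : ∀ m → sign (suc m) ≡ - sign m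
sign-suc zero          = refl
sign-suc (suc zero)    = refl
sign-suc (suc (suc m)) = sign-suc m

sign-+ : ∀ m n → sign (m ℕ.+ n) ≡ sign m * sign n
sign-+ zero          n = sym (*-identityˡ (sign n))
sign-+ (suc zero)    n = trans (sign-suc n) (sym (-1*i≡-i (sign n)))
sign-+ (suc (suc m)) n = sign-+ m n

sign-even : ∀ k → sign (k ℕ.* 2) ≡ + 1
sign-even zero    = refl
sign-even (suc k) = sign-even k

groundedCharPoly-lowCoeffs : ∀ m → HasLowCoeffs (groundedCharPoly m) (sign m) (- (sign m * triangle m))
groundedCharPoly-lowCoeffs zero          = [] , λ s → constant s
  where
  constant : ∀ s → + 1 ≡ + 1 + s * (+ 0 + s * + 0)
  constant = solve-∀
groundedCharPoly-lowCoeffs (suc zero)    = [] , λ s → linear s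
  where
  linear : ∀ s → s - + 1 ≡ - + 1 + s * (+ 1 + s * + 0)
  linear = solve-∀
groundedCharPoly-lowCoeffs (suc (suc m)) =
  subst₂ (HasLowCoeffs (groundedCharPoly (suc (suc m))))
         (trans (cong (λ σ → - + 2 * σ + - sign m) (sign-suc m)) (constant (sign m)))
         (trans (cong (λ σ → - + 2 * - (σ * triangle (suc m)) + + 1 * σ + - - (sign m * triangle m)) (sign-suc m))
                (linear (sign m) (triangle m) (+ m)))
         (HasLowCoeffs-+ (HasLowCoeffs-* (HasLowCoeffs-affine (- + 2)) (groundedCharPoly-lowCoeffs (suc m)))
                         (HasLowCoeffs-neg (groundedCharPoly-lowCoeffs m)))
  where
  constant : ∀ σ → - + 2 * - σ + - σ ≡ σ
  constant = solve-∀
  linear : ∀ σ t m → - + 2 * - (- σ * (t + (+ 1 + m))) + + 1 * - σ + - - (σ * t)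
                       ≡ - (σ * (t + (+ 1 + m) + (+ 2 + m)))
  linear = solve-∀

perturbation-lowCoeffs : ∀ j r → sign j * sign r ≡ + 1 →
  HasLowCoeffs (λ s → - (groundedCharPoly j s * groundedCharPoly r s)) (- + 1) (triangle j + triangle r)
perturbation-lowCoeffs j r σⱼσᵣ≡1 =
  subst₂ (HasLowCoeffs _)
         (cong -_ σⱼσᵣ≡1)
         (trans (factor (sign j) (sign r) (triangle j) (triangle r))
                (trans (cong (_* (triangle j + triangle r)) σⱼσᵣ≡1) (*-identityˡ (triangle j + triangle r))))
         (HasLowCoeffs-neg (HasLowCoeffs-* (groundedCharPoly-lowCoeffs j) (groundedCharPoly-lowCoeffs r)))
  where
  factor : ∀ a b x y → - (a * - (b * y) + - (a * x) * b) ≡ a * b * (x + y)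
  factor = solve-∀

triangle-double : ∀ m → triangle m * + 2 ≡ + m * (+ m + + 1)
triangle-double zero    = refl
triangle-double (suc m) =
  trans (distrib (triangle m) (+ m)) (trans (cong (_+ (+ 2 + + m * + 2)) (triangle-double m)) (square (+ m)))
  where
  distrib : ∀ t m → (t + (+ 1 + m)) * + 2 ≡ t * + 2 + (+ 2 + m * + 2)
  distrib = solve-∀
  square : ∀ m → m * (m + + 1) + (+ 2 + m * + 2) ≡ (+ 1 + m) * (+ 1 + m + + 1)
  square = solve-∀

triangle-complementary : ∀ j r k → j ℕ.+ r ≡ k ℕ.* 2 →
  triangle j + triangle r ≡ + k * + k + + k + (+ j - + k) ℤ.^ 2
triangle-complementary j r k j+r≡2k = *-cancelʳ-≡ _ _ (+ 2) (begin
  (triangle j + triangle r) * + 2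
    ≡⟨ distrib (triangle j) (triangle r) ⟩
  triangle j * + 2 + triangle r * + 2
    ≡⟨ cong₂ _+_ (triangle-double j) (triangle-double r) ⟩
  + j * (+ j + + 1) + + r * (+ r + + 1)
    ≡⟨ cong (λ x → + j * (+ j + + 1) + x * (x + + 1)) r≡2k-j ⟩
  + j * (+ j + + 1) + (+ k * + 2 - + j) * (+ k * + 2 - + j + + 1)
    ≡⟨ complete-square (+ j) (+ k) ⟩
  (+ k * + k + + k + (+ j - + k) ℤ.^ 2) * + 2 ∎)
  where
  distrib : ∀ x y → (x + y) * + 2 ≡ x * + 2 + y * + 2
  distrib = solve-∀
  isolate : ∀ x y → y ≡ x + y - x
  isolate = solve-∀
  complete-square : ∀ j k → j * (j + + 1) + (k * + 2 - j) * (k * + 2 - j + + 1) ≡ (k * k + k + (j - k) * ((j - k) * + 1)) * + 2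
  complete-square = solve-∀
  r≡2k-j : + r ≡ + k * + 2 - + j
  r≡2k-j = trans (isolate (+ j) (+ r)) (cong (_- + j) (trans (cong +_ j+r≡2k) (pos-* k 2)))

-- The paper's ((n−1)² + 2(n−1))/4 + (j − p*)², with 1-based vertex index suc j and p* = (n+1)/2.
middleCoefficient : ℕ → ℕ → ℤ
middleCoefficient n j = + ((((n ∸ 1) ^ 2) ℕ.+ 2 ℕ.* (n ∸ 1)) / 4) + ((+ (suc j) - + ((n ℕ.+ 1) / 2)) ℤ.^ 2)

middleCoefficient-odd : ∀ n k j → n ≡ suc (k ℕ.* 2) → middleCoefficient n j ≡ + k * + k + + k + (+ j - + k) ℤ.^ 2
middleCoefficient-odd _ k j refl = cong₂ _+_ quarter centred
  where
  quarter-identity : ∀ k → (k ℕ.* 2) ℕ.* ((k ℕ.* 2) ℕ.* 1) ℕ.+ 2 ℕ.* (k ℕ.* 2) ≡ (k ℕ.* k ℕ.+ k) ℕ.* 4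
  quarter-identity = ℕSolver.solve-∀
  half-identity : ∀ k → suc (k ℕ.* 2) ℕ.+ 1 ≡ suc k ℕ.* 2
  half-identity = ℕSolver.solve-∀
  shift : ∀ j k → (+ 1 + j - (+ 1 + k)) * ((+ 1 + j - (+ 1 + k)) * + 1) ≡ (j - k) * ((j - k) * + 1)
  shift = solve-∀
  quarter : + (((k ℕ.* 2) ^ 2 ℕ.+ 2 ℕ.* (k ℕ.* 2)) / 4) ≡ + k * + k + + k
  quarter = trans (cong (λ x → + (x / 4)) (quarter-identity k))
                  (trans (cong +_ (m*n/n≡m (k ℕ.* k ℕ.+ k) 4))
                         (trans (pos-+ (k ℕ.* k) k) (cong (_+ + k) (pos-* k k))))
  centred : (+ suc j - + ((suc (k ℕ.* 2) ℕ.+ 1) / 2)) ℤ.^ 2 ≡ (+ j - + k) ℤ.^ 2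
  centred = trans (cong (λ x → (+ suc j - + x) ℤ.^ 2) (trans (cong (_/ 2) (half-identity k)) (m*n/n≡m (suc k) 2)))
                  (shift (+ j) (+ k))

lemma7 : (n : ℕ) → 3 ≤ n → n % 2 ≡ 1 → (j : Fin n) →
    ∃ λ (rest : List ℤ) →
      (s ε : ℤ) →
        det n (charMat n s (perturbedLap n j ε))
          ≡ det n (charMat n s (pathLap n))
            + ε * eval (- (+ 1)
                        ∷ (+ ((((n ∸ 1) ^ 2) ℕ.+ 2 ℕ.* (n ∸ 1)) / 4)
                           + ((+ (suc (toℕ j)) - + ((n ℕ.+ 1) / 2)) ℤ.^ 2))
                        ∷ rest) s
lemma7 n _ n-odd jf = HasLowCoeffs.rest coeffs , λ s ε → begin
  det n (charMat n s (perturbedLap n jf ε))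
    ≡⟨ det-charMat-perturbedLap n s ε jf ⟩
  continuant n (update (pathDiagonal n s) j (- ε))
    ≡⟨ subst (λ m → continuant m (update (pathDiagonal m s) j (- ε))
                      ≡ continuant m (pathDiagonal m s) + - ε * E j s * E r s)
             j+1+r≡n (continuant-pathDiagonal-update j r s (- ε)) ⟩
  continuant n (pathDiagonal n s) + - ε * E j s * E r s
    ≡⟨ cong₂ _+_ (sym (det-charMat-pathLap n s)) (negate ε (E j s) (E r s)) ⟩
  det n (charMat n s (pathLap n)) + ε * - (E j s * E r s)
    ≡⟨ cong (λ x → det n (charMat n s (pathLap n)) + ε * x) (HasLowCoeffs.expansion coeffs s) ⟩
  det n (charMat n s (pathLap n)) + ε * eval (- + 1 ∷ middleCoefficient n j ∷ HasLowCoeffs.rest coeffs) s ∎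
  where
  E = groundedCharPoly
  j = toℕ jf
  r = n ∸ suc j
  k = n / 2
  j+1+r≡n : j ℕ.+ suc r ≡ n
  j+1+r≡n = trans (ℕₚ.+-suc j r) (ℕₚ.m+[n∸m]≡n (toℕ<n jf))
  n≡2k+1 : n ≡ suc (k ℕ.* 2)
  n≡2k+1 = trans (m≡m%n+[m/n]*n n 2) (cong (ℕ._+ k ℕ.* 2) n-odd)
  j+r≡2k : j ℕ.+ r ≡ k ℕ.* 2
  j+r≡2k = ℕₚ.suc-injective (trans (sym (ℕₚ.+-suc j r)) (trans j+1+r≡n n≡2k+1))
  coeffs : HasLowCoeffs (λ s → - (E j s * E r s)) (- + 1) (middleCoefficient n j)
  coeffs = subst (HasLowCoeffs _ (- + 1))
                 (trans (triangle-complementary j r k j+r≡2k) (sym (middleCoefficient-odd n k j n≡2k+1)))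
                 (perturbation-lowCoeffs j r (trans (sym (sign-+ j r)) (trans (cong sign j+r≡2k) (sign-even k))))
  negate : ∀ ε x y → - ε * x * y ≡ ε * - (x * y)
  negate = solve-∀
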